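{- Let $s$ be a string and $u=s[1..|u|]$ a prefix of $s$. Let $b$ be an op-border of $u$ with $0\le b<|u|$, and let $b_1,\dots,b_f,b_{f+1}$ be the blocks defined by $b$. Suppose some block $b_j$ with $j\in[1,f+1]$ contains a leftmost occurrence of $s$. Then each of the blocks $b_1,b_2,\dots,b_j$ contains a leftmost occurrence of $s$.
   Context: Strings are finite sequences over a totally ordered alphabet, indexed from $1$; $s[i..j]$ denotes a fragment. Two strings $x,y$ are order-isomorphic, written $x\approx y$, if $|x|=|y|$ and for all $i,j$ we have $x[i]\le x[j]$ iff $y[i]\le y[j]$. An integer $b$ with $0\le b\le|u|$ is an op-border of $u$ if $u[1..b]\approx u[|u|-b+1..|u|]$. The blocks defined by an op-border $b<|u|$ are obtained with $\Delta=|u|-b$: - $b_j=u[(j-1)\Delta+1..j\Delta]$ for $j=1,\dots,f$, where $f=\lfloor |u|/\Delta\rfloor$; - the incomplete block $b_{f+1}=u[f\Delta+1..|u|]$, possibly empty. A position $i$ of $s$ is a leftmost occurrence if $s[i']\ne s[i]$ for all $i'<i$. A block contains a leftmost occurrence if one of its positions (as positions of $s$) is a leftmost occurrence. -}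

module Defs where

open import Level using (Level)
open import Data.Nat using (ℕ; zero; suc; _+_; _*_; _∸_; _≤_; _<_; NonZero; >-nonZero)
open import Data.Nat.Properties using (m<n⇒0<n∸m)
open import Data.Nat.DivMod using (_/_)
open import Data.Fin using (Fin; toℕ; cast)
open import Data.List using (List; length; lookup; take; drop)
open import Data.Product using (Σ; _×_; ∃)
open import Relation.Binary.PropositionalEquality using (_≡_)
open import Relation.Binary.Bundles using (TotalOrder)
open import Relation.Nullary using (¬_)

-- Strings over a totally ordered alphabet (the carrier of a TotalOrder).
-- Positions are represented 0-based as Fin (length s): the 1-based
-- position p of the paper is the Fin index p - 1.
module _ {c ℓ₁ ℓ₂ : Level} (O : TotalOrder c ℓ₁ ℓ₂) where
  open TotalOrder O using (_≈_) renaming (Carrier to A; _≤_ to _≤ₐ_)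

  Str : Set c
  Str = List A

  OrderIso : Str → Str → Set ℓ₂
  OrderIso x y =
    Σ (length x ≡ length y) λ eq →
      ∀ (i j : Fin (length x)) →
        (lookup x i ≤ₐ lookup x j → lookup y (cast eq i) ≤ₐ lookup y (cast eq j))
        × (lookup y (cast eq i) ≤ₐ lookup y (cast eq j) → lookup x i ≤ₐ lookup x j)

  OpBorder : Str → ℕ → Set ℓ₂
  OpBorder u b = b ≤ length u × OrderIso (take b u) (drop (length u ∸ b) u)

  LeftmostOcc : (s : Str) → Fin (length s) → Set ℓ₁
  LeftmostOcc s i = ∀ (i' : Fin (length s)) → toℕ i' < toℕ i → ¬ (lookup s i' ≈ lookup s i)

numBlocks : (m b : ℕ) → b < m → ℕ
numBlocks m b b<m = _/_ m (m ∸ b) {{ >-nonZero (m<n⇒0<n∸m b<m) }}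

module _ {c ℓ₁ ℓ₂ : Level} (O : TotalOrder c ℓ₁ ℓ₂) where
  open TotalOrder O using (_≈_) renaming (Carrier to A; _≤_ to _≤ₐ_)

  -- Block j (1-based, j ∈ [1, f+1]) of the prefix u = s[1..m] w.r.t. op-border b
  -- (Δ = m - b) is u[(j-1)Δ+1 .. min(jΔ, m)] (for j ≤ f, jΔ ≤ m; for j = f+1 it is
  -- u[fΔ+1..m]).
  BlockHasLeftmost : (s : List A) → (m b j : ℕ) → Set ℓ₁
  BlockHasLeftmost s m b j =
    ∃ λ (p : Fin (length s)) →
      ((j ∸ 1) * (m ∸ b) ≤ toℕ p) × (toℕ p < j * (m ∸ b)) × (toℕ p < m)
      × LeftmostOcc O s p

{-# OPTIONS --safe #-}
-- If a position p of the second or a later block is a leftmost occurrence, so is p − Δ: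
-- a repetition s[i] ≈ s[p − Δ] with i < p − Δ would, through the order-isomorphism
-- u[1..b] ≈ u[Δ+1..|u|], give a repetition s[i + Δ] ≈ s[p] with i + Δ < p.
-- Shifting by Δ maps block b_{j+1} into b_j, so the blocks with a leftmost occurrence
-- are closed downwards.
module Submission where

open import Defs
open import Level using (Level)
open import Data.Nat using (ℕ; zero; suc; _+_; _*_; _∸_; _≤_; _<_; _≤′_; ≤′-reflexive; ≤′-step)
open import Data.Nat.Properties
open import Data.List using (List; _∷_; length; lookup; take; drop)
open import Data.List.Properties using (length-take)
open import Data.Fin using (Fin; toℕ; fromℕ<; cast) renaming (zero to fzero; suc to fsuc)
open import Data.Fin.Properties using (toℕ-fromℕ<; toℕ-cast; toℕ<n; toℕ-injective)
open import Data.Product using (Σ; _×_; _,_; proj₁; proj₂)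
open import Relation.Binary.PropositionalEquality
open import Relation.Binary.Bundles using (TotalOrder)

module _ {a} {A : Set a} where

  lookup-take : ∀ n (xs : List A) (i : Fin (length (take n xs))) (j : Fin (length xs)) →
                toℕ i ≡ toℕ j → lookup (take n xs) i ≡ lookup xs j
  lookup-take (suc n) (x ∷ xs) fzero    fzero    _ = refl
  lookup-take (suc n) (x ∷ xs) (fsuc i) (fsuc j) e = lookup-take n xs i j (suc-injective e)

  lookup-drop : ∀ n (xs : List A) (i : Fin (length (drop n xs))) (j : Fin (length xs)) →
                n + toℕ i ≡ toℕ j → lookup (drop n xs) i ≡ lookup xs j
  lookup-drop zero    xs       i j        e = cong (lookup xs) (toℕ-injective e)
  lookup-drop (suc n) (x ∷ xs) i (fsuc j) e = lookup-drop n xs i j (suc-injective e)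

  length-take-≤ : ∀ {n} (xs : List A) → n ≤ length xs → length (take n xs) ≡ n
  length-take-≤ {n} xs n≤ = trans (length-take n xs) (m≤n⇒m⊓n≡m n≤)

module _ {c ℓ₁ ℓ₂ : Level} (O : TotalOrder c ℓ₁ ℓ₂) where
  open TotalOrder O using (_≈_; reflexive; antisym; module Eq)

  OrderIso-resp-≈ : ∀ {x y} (iso : OrderIso O x y) (i j : Fin (length x)) →
                    lookup x i ≈ lookup x j →
                    lookup y (cast (proj₁ iso) i) ≈ lookup y (cast (proj₁ iso) j)
  OrderIso-resp-≈ (_ , iso) i j xᵢ≈xⱼ =
    antisym (proj₁ (iso i j) (reflexive xᵢ≈xⱼ)) (proj₁ (iso j i) (reflexive (Eq.sym xᵢ≈xⱼ)))

  OpBorder-shift-≈ : ∀ {u b} → OpBorder O u b → (i j i' j' : Fin (length u)) →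
                     toℕ i + (length u ∸ b) ≡ toℕ i' → toℕ j + (length u ∸ b) ≡ toℕ j' →
                     lookup u i ≈ lookup u j → lookup u i' ≈ lookup u j'
  OpBorder-shift-≈ {u} {b} (b≤|u| , iso) i j i' j' i+Δ≡i' j+Δ≡j' uᵢ≈uⱼ =
    subst₂ _≈_ (fromSuffix i+Δ≡i') (fromSuffix j+Δ≡j')
      (OrderIso-resp-≈ {take b u} {drop Δ u} iso (prefixIndex i+Δ≡i') (prefixIndex j+Δ≡j')
        (subst₂ _≈_ (sym (fromPrefix i+Δ≡i')) (sym (fromPrefix j+Δ≡j')) uᵢ≈uⱼ))
    where
    Δ : ℕ
    Δ = length u ∸ b

    inPrefix : ∀ {k k'} → toℕ k + Δ ≡ toℕ k' → toℕ k < length (take b u)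
    inPrefix {k} {k'} k+Δ≡k' = subst (toℕ k <_) (sym (length-take-≤ u b≤|u|))
      (+-cancelʳ-< Δ (toℕ k) b (subst₂ _<_ (sym k+Δ≡k') (sym (m+[n∸m]≡n b≤|u|)) (toℕ<n k')))

    prefixIndex : ∀ {k k'} → toℕ k + Δ ≡ toℕ k' → Fin (length (take b u))
    prefixIndex k+Δ≡k' = fromℕ< (inPrefix k+Δ≡k')

    fromPrefix : ∀ {k k'} (e : toℕ k + Δ ≡ toℕ k') → lookup (take b u) (prefixIndex e) ≡ lookup u k
    fromPrefix {k} e = lookup-take b u _ k (toℕ-fromℕ< _)

    fromSuffix : ∀ {k k'} (e : toℕ k + Δ ≡ toℕ k') →
                 lookup (drop Δ u) (cast (proj₁ iso) (prefixIndex e)) ≡ lookup u k'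
    fromSuffix {k} {k'} e = lookup-drop Δ u _ k' (begin
      Δ + toℕ (cast (proj₁ iso) (prefixIndex e)) ≡⟨ cong (Δ +_) (trans (toℕ-cast _ _) (toℕ-fromℕ< _)) ⟩
      Δ + toℕ k                                   ≡⟨ +-comm Δ (toℕ k) ⟩
      toℕ k + Δ                                   ≡⟨ e ⟩
      toℕ k'                                      ∎)
      where open ≡-Reasoning

module _ {c ℓ₁ ℓ₂ : Level} (O : TotalOrder c ℓ₁ ℓ₂) {s : List (TotalOrder.Carrier O)} {m b : ℕ}
         (m≤|s| : m ≤ length s) (border : OpBorder O (take m s) b) where
  open TotalOrder O using (_≈_)

  private
    Δ : ℕ
    Δ = m ∸ b

    toPrefix : (k : Fin (length s)) → toℕ k < m → Fin (length (take m s))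
    toPrefix k k<m = fromℕ< (subst (toℕ k <_) (sym (length-take-≤ s m≤|s|)) k<m)

    lookup-toPrefix : ∀ k (k<m : toℕ k < m) → lookup (take m s) (toPrefix k k<m) ≡ lookup s k
    lookup-toPrefix k k<m = lookup-take m s _ k (toℕ-fromℕ< _)

    shift-toPrefix : ∀ {k k'} (k'<m : toℕ k' < m) (k+Δ≡k' : toℕ k + Δ ≡ toℕ k') →
                     Σ (toℕ k < m) λ k<m →
                       toℕ (toPrefix k k<m) + (length (take m s) ∸ b) ≡ toℕ (toPrefix k' k'<m)
    shift-toPrefix {k} {k'} k'<m k+Δ≡k' = k<m , (begin
      toℕ (toPrefix k k<m) + (length (take m s) ∸ b) ≡⟨ cong₂ _+_ (toℕ-fromℕ< _) (cong (_∸ b) (length-take-≤ s m≤|s|)) ⟩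
      toℕ k + Δ                                      ≡⟨ k+Δ≡k' ⟩
      toℕ k'                                         ≡⟨ toℕ-fromℕ< _ ⟨
      toℕ (toPrefix k' k'<m)                         ∎)
      where
      open ≡-Reasoning
      k<m : toℕ k < m
      k<m = ≤-<-trans (m≤m+n (toℕ k) Δ) (subst (_< m) (sym k+Δ≡k') k'<m)

  take-OpBorder-shift-≈ : (i j i' j' : Fin (length s)) → toℕ i' < m → toℕ j' < m →
                          toℕ i + (m ∸ b) ≡ toℕ i' → toℕ j + (m ∸ b) ≡ toℕ j' →
                          lookup s i ≈ lookup s j → lookup s i' ≈ lookup s j'
  take-OpBorder-shift-≈ i j i' j' i'<m j'<m i+Δ≡i' j+Δ≡j' sᵢ≈sⱼ
    with shift-toPrefix i'<m i+Δ≡i' | shift-toPrefix j'<m j+Δ≡j'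
  ... | i<m , iShift | j<m , jShift =
    subst₂ _≈_ (lookup-toPrefix i' i'<m) (lookup-toPrefix j' j'<m)
      (OpBorder-shift-≈ O border _ _ _ _ iShift jShift
        (subst₂ _≈_ (sym (lookup-toPrefix i i<m)) (sym (lookup-toPrefix j j<m)) sᵢ≈sⱼ))

  LeftmostOcc-shift⁻ : (p : Fin (length s)) → m ∸ b ≤ toℕ p → toℕ p < m → LeftmostOcc O s p →
                       Σ (Fin (length s)) λ q → toℕ q + (m ∸ b) ≡ toℕ p × LeftmostOcc O s q
  LeftmostOcc-shift⁻ p Δ≤p p<m p-leftmost = q , q+Δ≡p , q-leftmost
    where
    q : Fin (length s)
    q = fromℕ< (≤-<-trans (m∸n≤m (toℕ p) Δ) (toℕ<n p))

    q+Δ≡p : toℕ q + Δ ≡ toℕ p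
    q+Δ≡p = trans (cong (_+ Δ) (toℕ-fromℕ< _)) (m∸n+n≡m Δ≤p)

    q-leftmost : LeftmostOcc O s q
    q-leftmost i i<q sᵢ≈sq =
      p-leftmost r r<p (take-OpBorder-shift-≈ i q r p (<-trans r<p p<m) p<m r≡i+Δ q+Δ≡p sᵢ≈sq)
      where
      i+Δ<p : toℕ i + Δ < toℕ p
      i+Δ<p = subst (toℕ i + Δ <_) q+Δ≡p (+-monoˡ-< Δ i<q)
      r : Fin (length s)
      r = fromℕ< (<-trans i+Δ<p (toℕ<n p))
      r≡i+Δ : toℕ i + Δ ≡ toℕ r
      r≡i+Δ = sym (toℕ-fromℕ< _)
      r<p : toℕ r < toℕ p
      r<p = subst (_< toℕ p) r≡i+Δ i+Δ<p

  BlockHasLeftmost-pred : ∀ j → BlockHasLeftmost O s m b (suc (suc j)) → BlockHasLeftmost O s m b (suc j)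
  BlockHasLeftmost-pred j (p , lo , hi , p<m , p-leftmost) = q , lo' , hi' , q<m , q-leftmost
    where
    shifted : Σ (Fin (length s)) λ q → toℕ q + Δ ≡ toℕ p × LeftmostOcc O s q
    shifted = LeftmostOcc-shift⁻ p (≤-trans (m≤m+n Δ (j * Δ)) lo) p<m p-leftmost
    q : Fin (length s)
    q = proj₁ shifted
    q+Δ≡p : toℕ q + Δ ≡ toℕ p
    q+Δ≡p = proj₁ (proj₂ shifted)
    q-leftmost : LeftmostOcc O s q
    q-leftmost = proj₂ (proj₂ shifted)
    lo' : j * Δ ≤ toℕ q
    lo' = +-cancelʳ-≤ Δ (j * Δ) (toℕ q) (subst₂ _≤_ (+-comm Δ (j * Δ)) (sym q+Δ≡p) lo)
    hi' : toℕ q < suc j * Δ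
    hi' = +-cancelʳ-< Δ (toℕ q) (suc j * Δ) (subst₂ _<_ (sym q+Δ≡p) (+-comm Δ (suc j * Δ)) hi)
    q<m : toℕ q < m
    q<m = ≤-<-trans (subst (toℕ q ≤_) q+Δ≡p (m≤m+n (toℕ q) Δ)) p<m

  BlockHasLeftmost-downward : ∀ {k j} → suc k ≤′ j → BlockHasLeftmost O s m b j → BlockHasLeftmost O s m b (suc k)
  BlockHasLeftmost-downward (≤′-reflexive refl) h = h
  BlockHasLeftmost-downward (≤′-step {zero} (≤′-reflexive ()))
  BlockHasLeftmost-downward (≤′-step {suc j} k<j) h = BlockHasLeftmost-downward k<j (BlockHasLeftmost-pred j h)

lemma10 : ∀ {c ℓ₁ ℓ₂ : Level} (O : TotalOrder c ℓ₁ ℓ₂)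
          (s : List (TotalOrder.Carrier O)) (m : ℕ) → m ≤ length s →
          (b : ℕ) (b<m : b < m) → OpBorder O (take m s) b →
          (j : ℕ) → 1 ≤ j → j ≤ numBlocks m b b<m + 1 →
          BlockHasLeftmost O s m b j →
          (k : ℕ) → 1 ≤ k → k ≤ j → BlockHasLeftmost O s m b k
lemma10 O s m m≤|s| b _ border j _ _ h (suc k) _ k≤j =
  BlockHasLeftmost-downward O m≤|s| border (≤⇒≤′ k≤j) h
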